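{- Let $k$ be an integer that has at least $3$ prime factors counted with multiplicity. Then there are only finitely many triples of primes $p,q,r$ such that $pqr \in C_k$, $p-1 \mid q-1$, and $p-1 \mid r-1$.
   Context: For an integer $k$, $C_k$ denotes the set of integers $n>\max(k,0)$ such that $a^{n-k+1}\equiv a \pmod{n}$ for all integers $a$. -}

module Defs where

open import Data.Nat as ℕ using (ℕ)
open import Data.Integer using (ℤ; +_; _+_; _-_; _^_; _<_; ∣_∣)
open import Data.Integer.Divisibility using (_∣_)
open import Data.Nat.Primality.Factorisation using (PrimeFactorisation; factors)
open import Data.List using (length)
open import Data.Product using (Σ; _×_)

-- n ∈ C_k :  n > max(k,0)  and  a^(n-k+1) ≡ a (mod n) for all integers a.
-- (Since n > k, the exponent n - k + 1 is a positive integer; we take its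
-- absolute value to get the natural-number exponent.)
InC : ℤ → ℕ → Set
InC k n = (0 ℕ.< n) × (k < + n) ×
  ((a : ℤ) → (+ n) ∣ (a ^ ∣ + n - k + + 1 ∣ - a))

-- Ω(|k|) ≥ 3 : |k| has a prime factorisation with at least three prime
-- factors counted with multiplicity (this forces k ≠ 0).
AtLeastThreePrimeFactors : ℤ → Set
AtLeastThreePrimeFactors k =
  Σ (PrimeFactorisation ∣ k ∣) λ F → 3 ℕ.≤ length (factors F)

module Submission where

-- If n ∈ C_k and s is a prime factor of n, then s − 1 ∣ n − k (a Korselt-type criterion):
-- every unit a mod s satisfies a^(n−k) ≡ 1, while by Fermat only multiples of s − 1 are such
-- universal exponents, because for 0 < v < s − 1 the v-th finite difference of y ↦ y^v − 1 is
-- v!, which s does not divide. For n = pqr with p − 1 ∣ q − 1 and p − 1 ∣ r − 1 this gives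
-- p − 1 ∣ 1 − k, which bounds p since k ≠ 1. With D = p − k ≠ 0 it also gives
-- q − 1 ∣ p (r − 1) + D and r − 1 ∣ p (q − 1) + D, and two such mutual divisibilities bound
-- q − 1 and r − 1 in terms of p and ∣D∣ (here k ≠ pq, pr is used). All three exclusions of k
-- follow from k having at least three prime factors.

open import Defs
open import Data.Nat as ℕ using (ℕ; zero; suc; _!; z≤n; s≤s)
import Data.Nat.Properties as ℕ
import Data.Nat.Divisibility as ℕ
open import Data.Nat.DivMod using (_%_; _/_; m≡m%n+[m/n]*n; m%n<n; m/n*n≡m)
open import Data.Nat.Combinatorics
  using (_C_; nCn≡1; nC1≡n; nCk≡nC[n∸k]; nCk≡n!/k![n-k]!; k![n∸k]!∣n!)
open import Data.Nat.Primality using (Prime; euclidsLemma; prime⇒nonTrivial)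
open import Data.Nat.Primality.Factorisation using (factorisationUnique)
open import Data.Nat.ListAction using (product)
open import Data.Fin as Fin using (Fin; toℕ; fromℕ; inject₁)
open import Data.Fin.Properties using (toℕ-fromℕ; toℕ-inject₁; toℕ<n)
open import Data.Integer using (ℤ; +_; _+_; _*_; _-_; -_; _^_; 0ℤ; 1ℤ; ∣_∣)
open import Data.Integer.Properties
  using ( +-*-semiring; +-*-commutativeSemiring; _≟_; pos-*; abs-*; <⇒≤
        ; +-comm; +-identityˡ; +-identityʳ; *-identityˡ; *-identityʳ; *-zeroʳ; *-distribʳ-+
        ; ^-zeroˡ; ^-distribˡ-+-*; ^-*-assoc; 0≤i⇒+∣i∣≡i; i≤j⇒0≤j-i; i-j≡0⇒i≡j; i*j≡0⇒i≡0∨j≡0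
        ; ∣i∣≡0⇒i≡0; ∣-i∣≡∣i∣; ∣i+j∣≤∣i∣+∣j∣; ∣i-j∣≤∣i∣+∣j∣ )
open import Data.Integer.Divisibility.Signed
  using ( _∣_; divides; ∣ᵤ⇒∣; ∣⇒∣ᵤ; ∣-refl; ∣-trans; ∣m⇒∣m*n; ∣n⇒∣m*n
        ; ∣m∣n⇒∣m+n; ∣m∣n⇒∣m-n; ∣m+n∣m⇒∣n; ∣m+n∣n⇒∣m )
open import Data.Integer.Tactic.RingSolver using (solve-∀)
open import Algebra.Properties.Semiring.Sum +-*-semiring
  using (sum; sum-syntax; sum-cong-≗; sum-init-last; sum-replicate-zero)
import Algebra.Properties.Semiring.Mult +-*-semiring as Mult
import Algebra.Properties.Semiring.Exp +-*-semiring as Exp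
import Algebra.Properties.CommutativeSemiring.Binomial +-*-commutativeSemiring as Binomial
open import Data.List using ([]; _∷_; length)
open import Data.List.Relation.Unary.All using (All; []; _∷_)
open import Data.List.Relation.Binary.Permutation.Propositional.Properties using (↭-length)
open import Data.Product using (Σ; _×_; _,_; proj₁; proj₂)
open import Data.Sum using (_⊎_; inj₁; inj₂)
open import Data.Empty using (⊥-elim)
open import Relation.Nullary using (¬_; yes; no)
open import Relation.Binary.PropositionalEquality

×≡* : ∀ n x → n Mult.× x ≡ + n * x
×≡* zero    x = refl
×≡* (suc n) x = begin
  x + n Mult.× x    ≡⟨ cong (_+_ x) (×≡* n x) ⟩
  x + + n * x       ≡⟨ cong (_+ + n * x) (*-identityˡ x) ⟨
  1ℤ * x + + n * x  ≡⟨ *-distribʳ-+ x 1ℤ (+ n) ⟨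
  + suc n * x       ∎
  where open ≡-Reasoning

^≡^ : ∀ x n → x Exp.^ n ≡ x ^ n
^≡^ x zero    = refl
^≡^ x (suc n) = cong (x *_) (^≡^ x n)

∑-last : ∀ n (f : ℕ → ℤ) → ∑[ i < suc n ] f (toℕ i) ≡ ∑[ i < n ] f (toℕ i) + f n
∑-last n f = begin
  ∑[ i < suc n ] f (toℕ i)                            ≡⟨ sum-init-last {n} (λ i → f (toℕ i)) ⟩
  ∑[ i < n ] f (toℕ (inject₁ i)) + f (toℕ (fromℕ n))  ≡⟨ cong₂ _+_ ∑-inject₁ (cong f (toℕ-fromℕ n)) ⟩
  ∑[ i < n ] f (toℕ i) + f n                          ∎
  where
  open ≡-Reasoning
  ∑-inject₁ : ∑[ i < n ] f (toℕ (inject₁ i)) ≡ ∑[ i < n ] f (toℕ i)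
  ∑-inject₁ = sum-cong-≗ {n} (λ i → cong f (toℕ-inject₁ i))

∑-zero : ∀ n {f : Fin n → ℤ} → (∀ i → f i ≡ 0ℤ) → sum f ≡ 0ℤ
∑-zero n f≡0 = trans (sum-cong-≗ f≡0) (sum-replicate-zero n)

∑-∣ : ∀ n {d} {f : Fin n → ℤ} → (∀ i → d ∣ f i) → d ∣ sum f
∑-∣ zero    d∣f = divides 0ℤ refl
∑-∣ (suc n) d∣f = ∣m∣n⇒∣m+n (d∣f Fin.zero) (∑-∣ n (λ i → d∣f (Fin.suc i)))

binomial : ∀ n x → (x + 1ℤ) ^ n ≡ ∑[ i < n ] (+ (n C toℕ i) * x ^ toℕ i) + x ^ n
binomial n x = begin
  (x + 1ℤ) ^ n                       ≡⟨ ^≡^ (x + 1ℤ) n ⟨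
  (x + 1ℤ) Exp.^ n                   ≡⟨ Binomial.theorem n x 1ℤ ⟩
  Binomial.binomialExpansion x 1ℤ n  ≡⟨ sum-cong-≗ term ⟩
  ∑[ i < suc n ] t (toℕ i)           ≡⟨ ∑-last n t ⟩
  S + + (n C n) * x ^ n              ≡⟨ cong (λ c → S + + c * x ^ n) (nCn≡1 n) ⟩
  S + 1ℤ * x ^ n                     ≡⟨ cong (_+_ S) (*-identityˡ (x ^ n)) ⟩
  S + x ^ n                          ∎
  where
  open ≡-Reasoning
  t : ℕ → ℤ
  t i = + (n C i) * x ^ i
  S : ℤ
  S = ∑[ i < n ] t (toℕ i)
  term : ∀ i → Binomial.binomialTerm x 1ℤ n i ≡ t (toℕ i)
  term i = begin
    c Mult.× (x Exp.^ toℕ i * 1ℤ Exp.^ (n ℕ.∸ toℕ i))  ≡⟨ ×≡* c _ ⟩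
    + c * (x Exp.^ toℕ i * 1ℤ Exp.^ (n ℕ.∸ toℕ i))     ≡⟨ cong (+ c *_) (cong₂ _*_ (^≡^ x (toℕ i)) 1^≡1) ⟩
    + c * (x ^ toℕ i * 1ℤ)                             ≡⟨ cong (+ c *_) (*-identityʳ (x ^ toℕ i)) ⟩
    t (toℕ i)                                          ∎
    where
    c : ℕ
    c = n C toℕ i
    1^≡1 : 1ℤ Exp.^ (n ℕ.∸ toℕ i) ≡ 1ℤ
    1^≡1 = trans (^≡^ 1ℤ (n ℕ.∸ toℕ i)) (^-zeroˡ (n ℕ.∸ toℕ i))

-- Finite differences

Δ : (ℤ → ℤ) → ℤ → ℤ
Δ f x = f (x + 1ℤ) - f x

Δ^ : ℕ → (ℤ → ℤ) → ℤ → ℤ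
Δ^ zero    f = f
Δ^ (suc d) f = Δ^ d (Δ f)

Δ^-cong : ∀ d {f g} → f ≗ g → Δ^ d f ≗ Δ^ d g
Δ^-cong zero    f≗g = f≗g
Δ^-cong (suc d) f≗g = Δ^-cong d (λ y → cong₂ _-_ (f≗g (y + 1ℤ)) (f≗g y))

Δ^-+ : ∀ d f g x → Δ^ d (λ y → f y + g y) x ≡ Δ^ d f x + Δ^ d g x
Δ^-+ zero    f g x = refl
Δ^-+ (suc d) f g x =
  trans (Δ^-cong d (λ y → lemma (f (y + 1ℤ)) (g (y + 1ℤ)) (f y) (g y)) x) (Δ^-+ d (Δ f) (Δ g) x)
  where
  lemma : ∀ a b c e → a + b - (c + e) ≡ (a - c) + (b - e)
  lemma = solve-∀

Δ^-*ˡ : ∀ d c f x → Δ^ d (λ y → c * f y) x ≡ c * Δ^ d f x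
Δ^-*ˡ zero    c f x = refl
Δ^-*ˡ (suc d) c f x =
  trans (Δ^-cong d (λ y → lemma c (f (y + 1ℤ)) (f y)) x) (Δ^-*ˡ d c (Δ f) x)
  where
  lemma : ∀ c a b → c * a - c * b ≡ c * (a - b)
  lemma = solve-∀

Δ^-0 : ∀ d x → Δ^ d (λ _ → 0ℤ) x ≡ 0ℤ
Δ^-0 zero    x = refl
Δ^-0 (suc d) x = Δ^-0 d x

Δ^-∑ : ∀ d n (F : Fin n → ℤ → ℤ) x → Δ^ d (λ y → ∑[ i < n ] F i y) x ≡ ∑[ i < n ] Δ^ d (F i) x
Δ^-∑ d zero    F x = Δ^-0 d x
Δ^-∑ d (suc n) F x =
  trans (Δ^-+ d (F Fin.zero) (λ y → ∑[ i < n ] F (Fin.suc i) y) x)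
        (cong (_+_ (Δ^ d (F Fin.zero) x)) (Δ^-∑ d n (λ i → F (Fin.suc i)) x))

Δ^-∣ : ∀ d f x {s} → (∀ i → i ℕ.≤ d → s ∣ f (x + + i)) → s ∣ Δ^ d f x
Δ^-∣ zero    f x s∣f = subst (λ y → _ ∣ f y) (+-identityʳ x) (s∣f 0 z≤n)
Δ^-∣ (suc d) f x s∣f = Δ^-∣ d (Δ f) x (λ i i≤d →
  ∣m∣n⇒∣m-n (subst (λ y → _ ∣ f y) (lemma x (+ i)) (s∣f (suc i) (s≤s i≤d)))
             (s∣f i (ℕ.m≤n⇒m≤1+n i≤d)))
  where
  lemma : ∀ x a → x + (1ℤ + a) ≡ x + a + 1ℤ
  lemma = solve-∀

Δ-pow : ∀ j x → Δ (_^ j) x ≡ ∑[ i < j ] (+ (j C toℕ i) * x ^ toℕ i)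
Δ-pow j x = trans (cong (_- x ^ j) (binomial j x)) (lemma _ (x ^ j))
  where
  lemma : ∀ a b → a + b - b ≡ a
  lemma = solve-∀

Δ^-suc-pow : ∀ d j x → Δ^ (suc d) (_^ j) x ≡ ∑[ i < j ] (+ (j C toℕ i) * Δ^ d (_^ toℕ i) x)
Δ^-suc-pow d j x = begin
  Δ^ d (Δ (_^ j)) x                    ≡⟨ Δ^-cong d (Δ-pow j) x ⟩
  Δ^ d (λ y → ∑[ i < j ] F i y) x      ≡⟨ Δ^-∑ d j F x ⟩
  ∑[ i < j ] Δ^ d (F i) x              ≡⟨ sum-cong-≗ {j} (λ i → Δ^-*ˡ d (c i) (_^ toℕ i) x) ⟩
  ∑[ i < j ] (c i * Δ^ d (_^ toℕ i) x)  ∎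
  where
  open ≡-Reasoning
  c : Fin j → ℤ
  c i = + (j C toℕ i)
  F : Fin j → ℤ → ℤ
  F i y = c i * y ^ toℕ i

Δ^-pow-< : ∀ {j d} → j ℕ.< d → ∀ x → Δ^ d (_^ j) x ≡ 0ℤ
Δ^-pow-< {j} {suc d} (s≤s j≤d) x = trans (Δ^-suc-pow d j x) (∑-zero j (λ i →
  trans (cong (+ (j C toℕ i) *_) (Δ^-pow-< (ℕ.<-≤-trans (toℕ<n i) j≤d) x))
        (*-zeroʳ (+ (j C toℕ i)))))

Δ^-pow-≡ : ∀ d x → Δ^ d (_^ d) x ≡ + (d !)
Δ^-pow-≡ zero    x = refl
Δ^-pow-≡ (suc d) x = begin
  Δ^ (suc d) (_^ suc d) x     ≡⟨ Δ^-suc-pow d (suc d) x ⟩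
  ∑[ i < suc d ] t (toℕ i)    ≡⟨ ∑-last d t ⟩
  ∑[ i < d ] t (toℕ i) + t d  ≡⟨ cong₂ _+_ lower-terms (cong₂ (λ c v → + c * v) [1+d]Cd≡1+d (Δ^-pow-≡ d x)) ⟩
  0ℤ + + suc d * + (d !)      ≡⟨ +-identityˡ _ ⟩
  + suc d * + (d !)           ≡⟨ pos-* (suc d) (d !) ⟨
  + (suc d !)                 ∎
  where
  open ≡-Reasoning
  t : ℕ → ℤ
  t i = + (suc d C i) * Δ^ d (_^ i) x
  lower-terms : ∑[ i < d ] t (toℕ i) ≡ 0ℤ
  lower-terms = ∑-zero d (λ i →
    trans (cong (+ (suc d C toℕ i) *_) (Δ^-pow-< (toℕ<n i) x)) (*-zeroʳ (+ (suc d C toℕ i))))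
  [1+d]Cd≡1+d : suc d C d ≡ suc d
  [1+d]Cd≡1+d =
    trans (nCk≡nC[n∸k] (ℕ.n≤1+n d)) (trans (cong (suc d C_) (ℕ.m+n∸n≡m 1 d)) (nC1≡n (suc d)))

prime⇒2≤p : ∀ {p} → Prime p → 2 ℕ.≤ p
prime⇒2≤p {p} pp = ℕ.nonTrivial⇒n>1 p {{prime⇒nonTrivial pp}}

p∣n!⇒p≤n : ∀ {p} → Prime p → ∀ n → p ℕ.∣ n ! → p ℕ.≤ n
p∣n!⇒p≤n pp zero    p∣1  = ⊥-elim (ℕ.<⇒≢ (prime⇒2≤p pp) (sym (ℕ.∣1⇒≡1 p∣1)))
p∣n!⇒p≤n pp (suc n) p∣n! with euclidsLemma (suc n) (n !) pp p∣n!
... | inj₁ p∣1+n = ℕ.∣⇒≤ p∣1+n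
... | inj₂ p∣n!′ = ℕ.m≤n⇒m≤1+n (p∣n!⇒p≤n pp n p∣n!′)

nCk*k![n∸k]!≡n! : ∀ {n k} → k ℕ.≤ n → (n C k) ℕ.* (k ! ℕ.* (n ℕ.∸ k) !) ≡ n !
nCk*k![n∸k]!≡n! {n} {k} k≤n =
  trans (cong (ℕ._* (k ! ℕ.* (n ℕ.∸ k) !)) (nCk≡n!/k![n-k]! k≤n)) (m/n*n≡m (k![n∸k]!∣n! k≤n))
  where instance _ = k ℕ.!* (n ℕ.∸ k) !≢0

p∣pCk : ∀ {p k} → Prime p → 0 ℕ.< k → k ℕ.< p → p ℕ.∣ p C k
p∣pCk {p@(suc p′)} {k} pp 0<k k<p
  with euclidsLemma (p C k) (k ! ℕ.* (p ℕ.∸ k) !) pp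
         (subst (p ℕ.∣_) (sym (nCk*k![n∸k]!≡n! (ℕ.<⇒≤ k<p))) (ℕ.m∣m*n (p′ !)))
... | inj₁ p∣pCk = p∣pCk
... | inj₂ p∣k![p∸k]! with euclidsLemma (k !) ((p ℕ.∸ k) !) pp p∣k![p∸k]!
...   | inj₁ p∣k!     = ⊥-elim (ℕ.<⇒≱ k<p (p∣n!⇒p≤n pp k p∣k!))
...   | inj₂ p∣[p∸k]! =
  ⊥-elim (ℕ.<⇒≱ (ℕ.∸-monoʳ-< 0<k (ℕ.<⇒≤ k<p)) (p∣n!⇒p≤n pp (p ℕ.∸ k) p∣[p∸k]!))

euclidsLemmaℤ : ∀ {p} → Prime p → ∀ x y → + p ∣ x * y → (+ p ∣ x) ⊎ (+ p ∣ y)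
euclidsLemmaℤ pp x y p∣xy with euclidsLemma ∣ x ∣ ∣ y ∣ pp (subst (_ ℕ.∣_) (abs-* x y) (∣⇒∣ᵤ p∣xy))
... | inj₁ p∣x = inj₁ (∣ᵤ⇒∣ p∣x)
... | inj₂ p∣y = inj₂ (∣ᵤ⇒∣ p∣y)

p∣a*x⇒p∣x : ∀ {p a} x → Prime p → 1 ℕ.≤ a → a ℕ.< p → + p ∣ + a * x → + p ∣ x
p∣a*x⇒p∣x {a = a} x pp 1≤a a<p p∣ax with euclidsLemmaℤ pp (+ a) x p∣ax
... | inj₁ p∣a = ⊥-elim (ℕ.<⇒≱ a<p (ℕ.∣⇒≤ {{ℕ.>-nonZero 1≤a}} (∣⇒∣ᵤ p∣a)))
... | inj₂ p∣x = p∣x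

fermat : ∀ {p} → Prime p → ∀ a → + p ∣ (+ a) ^ p - + a
fermat {p@(suc p′)} pp zero    = divides 0ℤ refl
fermat {p@(suc p′)} pp (suc a) = subst (+ p ∣_) (sym expand) (∣m∣n⇒∣m+n p∣M (fermat pp a))
  where
  x M : ℤ
  x = + a
  M = ∑[ i < p′ ] (+ (p C suc (toℕ i)) * x ^ suc (toℕ i))
  p∣M : + p ∣ M
  p∣M = ∑-∣ p′ (λ i → ∣m⇒∣m*n (x ^ suc (toℕ i))
          (∣ᵤ⇒∣ {+ p} {+ (p C suc (toℕ i))} (p∣pCk pp (s≤s z≤n) (s≤s (toℕ<n i)))))
  expand : (+ suc a) ^ p - + suc a ≡ M + (x ^ p - x)
  expand = begin
    (1ℤ + x) ^ p - (1ℤ + x)        ≡⟨ cong (λ y → y ^ p - y) (+-comm 1ℤ x) ⟩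
    (x + 1ℤ) ^ p - (x + 1ℤ)        ≡⟨ lemma ((x + 1ℤ) ^ p) (x ^ p) x ⟩
    Δ (_^ p) x - 1ℤ + (x ^ p - x)  ≡⟨ cong (λ y → y - 1ℤ + (x ^ p - x)) (Δ-pow p x) ⟩
    1ℤ + M - 1ℤ + (x ^ p - x)      ≡⟨ lemma′ M (x ^ p - x) ⟩
    M + (x ^ p - x)                ∎
    where
    open ≡-Reasoning
    lemma : ∀ a b x → a - (x + 1ℤ) ≡ a - b - 1ℤ + (b - x)
    lemma = solve-∀
    lemma′ : ∀ a b → 1ℤ + a - 1ℤ + b ≡ a + b
    lemma′ = solve-∀

-- Universal exponents modulo a prime

∣x-1⇒∣x^n-1 : ∀ {d x} n → d ∣ x - 1ℤ → d ∣ x ^ n - 1ℤ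
∣x-1⇒∣x^n-1         zero    d∣x-1 = divides 0ℤ refl
∣x-1⇒∣x^n-1 {d} {x} (suc n) d∣x-1 =
  subst (d ∣_) (lemma x (x ^ n)) (∣m∣n⇒∣m+n (∣n⇒∣m*n x (∣x-1⇒∣x^n-1 n d∣x-1)) d∣x-1)
  where
  lemma : ∀ x y → x * (y - 1ℤ) + (x - 1ℤ) ≡ x * y - 1ℤ
  lemma = solve-∀

∣x*y-1⇒∣x-1 : ∀ {d} x y → d ∣ x * y - 1ℤ → d ∣ y - 1ℤ → d ∣ x - 1ℤ
∣x*y-1⇒∣x-1 {d} x y d∣xy-1 d∣y-1 =
  subst (d ∣_) (lemma x y) (∣m∣n⇒∣m-n d∣xy-1 (∣n⇒∣m*n x d∣y-1))
  where
  lemma : ∀ x y → x * y - 1ℤ - x * (y - 1ℤ) ≡ x - 1ℤ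
  lemma = solve-∀

x^[1+n]-x≡x*[x^n-1] : ∀ x n → x ^ suc n - x ≡ x * (x ^ n - 1ℤ)
x^[1+n]-x≡x*[x^n-1] x n = lemma x (x ^ n)
  where
  lemma : ∀ x y → x * y - x ≡ x * (y - 1ℤ)
  lemma = solve-∀

UniversalExponent : ℕ → ℕ → Set
UniversalExponent p t = ∀ a → 1 ℕ.≤ a → a ℕ.< p → + p ∣ (+ a) ^ t - 1ℤ

fermat-universal : ∀ {p} → Prime p → UniversalExponent p (p ℕ.∸ 1)
fermat-universal {p@(suc p′)} pp a 1≤a a<p = p∣a*x⇒p∣x ((+ a) ^ p′ - 1ℤ) pp 1≤a a<p
  (subst (+ p ∣_) (x^[1+n]-x≡x*[x^n-1] (+ a) p′) (fermat pp a))

universal-* : ∀ {p e} → UniversalExponent p e → ∀ u → UniversalExponent p (e ℕ.* u)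
universal-* {p} {e} ue u a 1≤a a<p =
  subst (λ y → + p ∣ y - 1ℤ) (^-*-assoc (+ a) e u) (∣x-1⇒∣x^n-1 u (ue a 1≤a a<p))

universal-+-cancelʳ : ∀ {p} v w → UniversalExponent p (v ℕ.+ w) → UniversalExponent p w →
                      UniversalExponent p v
universal-+-cancelʳ {p} v w uv+w uw a 1≤a a<p = ∣x*y-1⇒∣x-1 ((+ a) ^ v) ((+ a) ^ w)
  (subst (λ y → + p ∣ y - 1ℤ) (^-distribˡ-+-* (+ a) v w) (uv+w a 1≤a a<p)) (uw a 1≤a a<p)

-- Δ^v (y ↦ y ^ v - 1) is the constant v!, yet it is an integer combination of
-- the values at 1, …, v + 1 < p, all divisible by p.
¬universal : ∀ {p v} → Prime p → 0 ℕ.< v → 2 ℕ.+ v ℕ.≤ p → ¬ UniversalExponent p v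
¬universal {p} {v@(suc d)} pp 0<v 2+v≤p uv =
  ℕ.<⇒≱ (ℕ.<-≤-trans (ℕ.m<n+m v {2} (s≤s z≤n)) 2+v≤p) (p∣n!⇒p≤n pp v p∣v!)
  where
  f : ℤ → ℤ
  f y = y ^ v - 1ℤ
  p∣Δ^f : + p ∣ Δ^ v f 1ℤ
  p∣Δ^f = Δ^-∣ v f 1ℤ (λ i i≤v → uv (suc i) (s≤s z≤n) (ℕ.<-≤-trans (s≤s (s≤s i≤v)) 2+v≤p))
  Δ^f≡v! : Δ^ v f 1ℤ ≡ + (v !)
  Δ^f≡v! = trans (Δ^-cong d (λ y → lemma ((y + 1ℤ) ^ v) (y ^ v)) 1ℤ) (Δ^-pow-≡ v 1ℤ)
    where
    lemma : ∀ a b → a - 1ℤ - (b - 1ℤ) ≡ a - b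
    lemma = solve-∀
  p∣v! : p ℕ.∣ v !
  p∣v! = ∣⇒∣ᵤ (subst (+ p ∣_) Δ^f≡v! p∣Δ^f)

universal⇒∣ : ∀ {p t} → Prime p → UniversalExponent p t → (p ℕ.∸ 1) ℕ.∣ t
universal⇒∣ {p@(suc (suc m))} {t} pp ut with t % suc m in t%≡ | m%n<n t (suc m)
... | zero  | _     = ℕ.m%n≡0⇒n∣m t (suc m) t%≡
... | suc r | r<1+m =
  ⊥-elim (¬universal pp (s≤s z≤n) (s≤s r<1+m) (universal-+-cancelʳ (suc r) (q ℕ.* suc m) u′ u″))
  where
  q : ℕ
  q = t / suc m
  u′ : UniversalExponent p (suc r ℕ.+ q ℕ.* suc m)
  u′ = subst (UniversalExponent p) (trans (m≡m%n+[m/n]*n t (suc m)) (cong (ℕ._+ q ℕ.* suc m) t%≡)) ut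
  u″ : UniversalExponent p (q ℕ.* suc m)
  u″ = subst (UniversalExponent p) (ℕ.*-comm (suc m) q) (universal-* {e = suc m} (fermat-universal pp) q)

InC⇒p-1∣n-k : ∀ {k n p} → InC k n → Prime p → p ℕ.∣ n → + (p ℕ.∸ 1) ∣ + n - k
InC⇒p-1∣n-k {k} {n} {p} (_ , k<n , n∣a^[n-k+1]-a) pp p∣n =
  subst (+ (p ℕ.∸ 1) ∣_) t≡n-k (∣ᵤ⇒∣ (universal⇒∣ pp universal))
  where
  t : ℕ
  t = ∣ + n - k ∣
  t≡n-k : + t ≡ + n - k
  t≡n-k = 0≤i⇒+∣i∣≡i (i≤j⇒0≤j-i (<⇒≤ k<n))
  universal : UniversalExponent p t
  universal a 1≤a a<p = p∣a*x⇒p∣x ((+ a) ^ t - 1ℤ) pp 1≤a a<p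
    (subst (+ p ∣_) factor (∣-trans {+ p} {+ n} (∣ᵤ⇒∣ p∣n) (∣ᵤ⇒∣ (n∣a^[n-k+1]-a (+ a)))))
    where
    factor : (+ a) ^ ∣ + n - k + + 1 ∣ - + a ≡ + a * ((+ a) ^ t - 1ℤ)
    factor = begin
      (+ a) ^ ∣ + n - k + + 1 ∣ - + a  ≡⟨ cong (λ y → (+ a) ^ ∣ y + + 1 ∣ - + a) t≡n-k ⟨
      (+ a) ^ (t ℕ.+ 1) - + a          ≡⟨ cong (λ e → (+ a) ^ e - + a) (ℕ.+-comm t 1) ⟩
      (+ a) ^ suc t - + a              ≡⟨ x^[1+n]-x≡x*[x^n-1] (+ a) t ⟩
      + a * ((+ a) ^ t - 1ℤ)           ∎
      where open ≡-Reasoning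

-- Mutual divisibility

∣⇒∣∣≤∣∣ : ∀ {a b} → a ∣ b → b ≢ 0ℤ → ∣ a ∣ ℕ.≤ ∣ b ∣
∣⇒∣∣≤∣∣ a∣b b≢0 = ℕ.∣⇒≤ {{ℕ.≢-nonZero (λ ∣b∣≡0 → b≢0 (∣i∣≡0⇒i≡0 ∣b∣≡0))}} (∣⇒∣ᵤ a∣b)

∣px+D∣≤px+∣D∣ : ∀ p x D → ∣ + p * + x + D ∣ ℕ.≤ p ℕ.* x ℕ.+ ∣ D ∣
∣px+D∣≤px+∣D∣ p x D =
  ℕ.≤-trans (∣i+j∣≤∣i∣+∣j∣ (+ p * + x) D) (ℕ.≤-reflexive (cong (ℕ._+ ∣ D ∣) (abs-* (+ p) (+ x))))

quotient-bound : ∀ p {x y} D m → 1 ℕ.≤ y → x ℕ.≤ y → + p * + x + D ≡ m * + y →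
                 ∣ m ∣ ℕ.≤ p ℕ.+ ∣ D ∣
quotient-bound p {x} {y} D m 1≤y x≤y px+D≡my =
  ℕ.*-cancelʳ-≤ ∣ m ∣ (p ℕ.+ ∣ D ∣) y (begin
    ∣ m ∣ ℕ.* y              ≡⟨ abs-* m (+ y) ⟨
    ∣ m * + y ∣              ≡⟨ cong ∣_∣ px+D≡my ⟨
    ∣ + p * + x + D ∣        ≤⟨ ∣px+D∣≤px+∣D∣ p x D ⟩
    p ℕ.* x ℕ.+ ∣ D ∣        ≤⟨ ℕ.+-mono-≤ (ℕ.*-monoʳ-≤ p x≤y) (ℕ.m≤m*n ∣ D ∣ y) ⟩
    p ℕ.* y ℕ.+ ∣ D ∣ ℕ.* y  ≡⟨ ℕ.*-distribʳ-+ y p ∣ D ∣ ⟨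
    (p ℕ.+ ∣ D ∣) ℕ.* y      ∎)
  where
  open ℕ.≤-Reasoning
  instance _ = ℕ.>-nonZero 1≤y

module _ (P x y m D : ℤ) (Px+D≡my : P * x + D ≡ m * y) where
  open ≡-Reasoning

  [P+m]D≡m[Py+D]-PPx : (P + m) * D ≡ m * (P * y + D) - P * P * x
  [P+m]D≡m[Py+D]-PPx = begin
    (P + m) * D                          ≡⟨ lemma₁ P m D x ⟩
    P * (P * x + D) + m * D - P * P * x  ≡⟨ cong (λ z → P * z + m * D - P * P * x) Px+D≡my ⟩
    P * (m * y) + m * D - P * P * x      ≡⟨ lemma₂ P m D x y ⟩
    m * (P * y + D) - P * P * x          ∎
    where
    lemma₁ : ∀ P m D x → (P + m) * D ≡ P * (P * x + D) + m * D - P * P * x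
    lemma₁ = solve-∀
    lemma₂ : ∀ P m D x y → P * (m * y) + m * D - P * P * x ≡ m * (P * y + D) - P * P * x
    lemma₂ = solve-∀

  P+m≡0⇒D≡-P[x+y] : P + m ≡ 0ℤ → D ≡ - (P * (x + y))
  P+m≡0⇒D≡-P[x+y] P+m≡0 = begin
    D                          ≡⟨ lemma₁ (P * x) D ⟩
    P * x + D - P * x          ≡⟨ cong (_- P * x) Px+D≡my ⟩
    m * y - P * x              ≡⟨ lemma₂ P m x y ⟩
    (P + m) * y - P * (x + y)  ≡⟨ cong (λ z → z * y - P * (x + y)) P+m≡0 ⟩
    0ℤ * y - P * (x + y)       ≡⟨ lemma₃ y (P * (x + y)) ⟩
    - (P * (x + y))            ∎
    where
    lemma₁ : ∀ a b → b ≡ a + b - a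
    lemma₁ = solve-∀
    lemma₂ : ∀ P m x y → m * y - P * x ≡ (P + m) * y - P * (x + y)
    lemma₂ = solve-∀
    lemma₃ : ∀ a b → 0ℤ * a - b ≡ - b
    lemma₃ = solve-∀

mutualDivisorBound : ℕ → ℕ → ℕ
mutualDivisorBound p d = p ℕ.* ((p ℕ.+ (p ℕ.+ d)) ℕ.* d) ℕ.+ d

d≤mutualDivisorBound : ∀ p d → d ℕ.≤ mutualDivisorBound p d
d≤mutualDivisorBound p d = ℕ.m≤n+m d (p ℕ.* ((p ℕ.+ (p ℕ.+ d)) ℕ.* d))

mutualDivisorBound-mono : ∀ {p p′ d d′} → p ℕ.≤ p′ → d ℕ.≤ d′ →
                          mutualDivisorBound p d ℕ.≤ mutualDivisorBound p′ d′
mutualDivisorBound-mono p≤p′ d≤d′ =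
  ℕ.+-mono-≤ (ℕ.*-mono-≤ p≤p′ (ℕ.*-mono-≤ (ℕ.+-mono-≤ p≤p′ (ℕ.+-mono-≤ p≤p′ d≤d′)) d≤d′)) d≤d′

-- Writing p x + D = m y, the divisibility x ∣ p y + D becomes x ∣ (p + m) D,
-- with ∣ m ∣ ≤ p + ∣ D ∣; when p + m = 0 instead, D = - p (x + y).
mutual-∣⇒larger≤ : ∀ p {x y D} .{{_ : ℕ.NonZero p}} → 1 ℕ.≤ x → x ℕ.≤ y →
                   D ≢ 0ℤ → + p * + x + D ≢ 0ℤ → + x ∣ + p * + y + D → + y ∣ + p * + x + D →
                   y ℕ.≤ mutualDivisorBound p ∣ D ∣
mutual-∣⇒larger≤ p {x} {y} {D} 1≤x x≤y D≢0 px+D≢0 x∣py+D (divides m px+D≡my) with + p + m ≟ 0ℤ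
... | yes p+m≡0 = begin
  y                           ≤⟨ ℕ.m≤n+m y x ⟩
  x ℕ.+ y                     ≤⟨ ℕ.m≤n*m (x ℕ.+ y) p ⟩
  p ℕ.* (x ℕ.+ y)             ≡⟨ ∣D∣≡p[x+y] ⟨
  ∣ D ∣                       ≤⟨ d≤mutualDivisorBound p ∣ D ∣ ⟩
  mutualDivisorBound p ∣ D ∣  ∎
  where
  open ℕ.≤-Reasoning
  ∣D∣≡p[x+y] : ∣ D ∣ ≡ p ℕ.* (x ℕ.+ y)
  ∣D∣≡p[x+y] = begin-equality
    ∣ D ∣                      ≡⟨ cong ∣_∣ (P+m≡0⇒D≡-P[x+y] (+ p) (+ x) (+ y) m D px+D≡my p+m≡0) ⟩
    ∣ - (+ p * (+ x + + y)) ∣  ≡⟨ ∣-i∣≡∣i∣ (+ p * (+ x + + y)) ⟩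
    ∣ + p * (+ x + + y) ∣      ≡⟨ abs-* (+ p) (+ x + + y) ⟩
    p ℕ.* (x ℕ.+ y)            ∎
... | no p+m≢0 = begin
  y                           ≤⟨ ∣⇒∣∣≤∣∣ (divides m px+D≡my) px+D≢0 ⟩
  ∣ + p * + x + D ∣           ≤⟨ ∣px+D∣≤px+∣D∣ p x D ⟩
  p ℕ.* x ℕ.+ ∣ D ∣           ≤⟨ ℕ.+-monoˡ-≤ ∣ D ∣ (ℕ.*-monoʳ-≤ p x≤[p+∣m∣]∣D∣) ⟩
  mutualDivisorBound p ∣ D ∣  ∎
  where
  open ℕ.≤-Reasoning
  x∣[p+m]D : + x ∣ (+ p + m) * D
  x∣[p+m]D = subst (+ x ∣_) (sym ([P+m]D≡m[Py+D]-PPx (+ p) (+ x) (+ y) m D px+D≡my))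
    (∣m∣n⇒∣m-n (∣n⇒∣m*n m x∣py+D) (∣n⇒∣m*n (+ p * + p) ∣-refl))
  [p+m]D≢0 : (+ p + m) * D ≢ 0ℤ
  [p+m]D≢0 eq with i*j≡0⇒i≡0∨j≡0 (+ p + m) eq
  ... | inj₁ p+m≡0 = p+m≢0 p+m≡0
  ... | inj₂ D≡0   = D≢0 D≡0
  ∣p+m∣≤p+[p+∣D∣] : ∣ + p + m ∣ ℕ.≤ p ℕ.+ (p ℕ.+ ∣ D ∣)
  ∣p+m∣≤p+[p+∣D∣] = ℕ.≤-trans (∣i+j∣≤∣i∣+∣j∣ (+ p) m)
    (ℕ.+-monoʳ-≤ p (quotient-bound p D m (ℕ.≤-trans 1≤x x≤y) x≤y px+D≡my))
  x≤[p+∣m∣]∣D∣ : x ℕ.≤ (p ℕ.+ (p ℕ.+ ∣ D ∣)) ℕ.* ∣ D ∣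
  x≤[p+∣m∣]∣D∣ = begin
    x                                ≤⟨ ∣⇒∣∣≤∣∣ x∣[p+m]D [p+m]D≢0 ⟩
    ∣ (+ p + m) * D ∣                ≡⟨ abs-* (+ p + m) D ⟩
    ∣ + p + m ∣ ℕ.* ∣ D ∣            ≤⟨ ℕ.*-monoˡ-≤ ∣ D ∣ ∣p+m∣≤p+[p+∣D∣] ⟩
    (p ℕ.+ (p ℕ.+ ∣ D ∣)) ℕ.* ∣ D ∣  ∎

mutual-∣⇒≤ : ∀ p {x y D} .{{_ : ℕ.NonZero p}} → 1 ℕ.≤ x → 1 ℕ.≤ y →
             D ≢ 0ℤ → + p * + x + D ≢ 0ℤ → + p * + y + D ≢ 0ℤ →
             + x ∣ + p * + y + D → + y ∣ + p * + x + D →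
             x ℕ.≤ mutualDivisorBound p ∣ D ∣ × y ℕ.≤ mutualDivisorBound p ∣ D ∣
mutual-∣⇒≤ p {x} {y} 1≤x 1≤y D≢0 px+D≢0 py+D≢0 x∣py+D y∣px+D with ℕ.≤-total x y
... | inj₁ x≤y = ℕ.≤-trans x≤y y≤b , y≤b
  where y≤b = mutual-∣⇒larger≤ p 1≤x x≤y D≢0 px+D≢0 x∣py+D y∣px+D
... | inj₂ y≤x = x≤b , ℕ.≤-trans y≤x x≤b
  where x≤b = mutual-∣⇒larger≤ p 1≤y y≤x D≢0 py+D≢0 y∣px+D x∣py+D

Ω≥3⇒length≥3 : ∀ {k} → AtLeastThreePrimeFactors k →
               ∀ ps → All Prime ps → ∣ k ∣ ≡ product ps → 3 ℕ.≤ length ps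
Ω≥3⇒length≥3 (F , 3≤∣F∣) ps ps-prime ∣k∣≡∏ps =
  subst (3 ℕ.≤_) (↭-length (factorisationUnique F F′)) 3≤∣F∣
  where
  F′ = record { factors = ps ; isFactorisation = ∣k∣≡∏ps ; factorsPrime = ps-prime }

Ω≥3⇒≢1 : ∀ {k} → AtLeastThreePrimeFactors k → k ≢ 1ℤ
Ω≥3⇒≢1 Ω refl with Ω≥3⇒length≥3 {1ℤ} Ω [] [] refl
... | ()

Ω≥3⇒≢p : ∀ {k p} → AtLeastThreePrimeFactors k → Prime p → k ≢ + p
Ω≥3⇒≢p {p = p} Ω pp refl with Ω≥3⇒length≥3 {+ p} Ω (p ∷ []) (pp ∷ []) (sym (ℕ.*-identityʳ p))
... | s≤s ()

Ω≥3⇒≢pq : ∀ {k p q} → AtLeastThreePrimeFactors k → Prime p → Prime q → k ≢ + (p ℕ.* q)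
Ω≥3⇒≢pq {p = p} {q} Ω pp pq refl
  with Ω≥3⇒length≥3 {+ (p ℕ.* q)} Ω (p ∷ q ∷ []) (pp ∷ pq ∷ []) (cong (p ℕ.*_) (sym (ℕ.*-identityʳ q)))
... | s≤s (s≤s ())

module _ (P x y k : ℤ) where

  x∣n-k⇒x∣P[1+y]-k : x ∣ P * (1ℤ + x) * (1ℤ + y) - k → x ∣ P * (1ℤ + y) - k
  x∣n-k⇒x∣P[1+y]-k x∣n-k =
    ∣m+n∣m⇒∣n (subst (x ∣_) (lemma P x y k) x∣n-k) (∣m⇒∣m*n (P * (1ℤ + y)) ∣-refl)
    where
    lemma : ∀ P x y k → P * (1ℤ + x) * (1ℤ + y) - k ≡ x * (P * (1ℤ + y)) + (P * (1ℤ + y) - k)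
    lemma = solve-∀

  y∣n-k⇒y∣P[1+x]-k : y ∣ P * (1ℤ + x) * (1ℤ + y) - k → y ∣ P * (1ℤ + x) - k
  y∣n-k⇒y∣P[1+x]-k y∣n-k =
    ∣m+n∣m⇒∣n (subst (y ∣_) (lemma P x y k) y∣n-k) (∣m⇒∣m*n (P * (1ℤ + x)) ∣-refl)
    where
    lemma : ∀ P x y k → P * (1ℤ + x) * (1ℤ + y) - k ≡ y * (P * (1ℤ + x)) + (P * (1ℤ + x) - k)
    lemma = solve-∀

w∣n-k⇒w∣1-k : ∀ w x y k → w ∣ x → w ∣ y → w ∣ (1ℤ + w) * (1ℤ + x) * (1ℤ + y) - k → w ∣ 1ℤ - k
w∣n-k⇒w∣1-k w x y k w∣x w∣y w∣n-k =
  ∣m+n∣n⇒∣m (subst (w ∣_) (lemma w x y k) w∣n-k)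
    (∣m∣n⇒∣m+n (∣m∣n⇒∣m+n (∣m⇒∣m*n ((1ℤ + x) * (1ℤ + y)) ∣-refl) (∣m⇒∣m*n (1ℤ + y) w∣x)) w∣y)
  where
  lemma : ∀ w x y k → (1ℤ + w) * (1ℤ + x) * (1ℤ + y) - k ≡
                      (1ℤ - k) + (w * ((1ℤ + x) * (1ℤ + y)) + x * (1ℤ + y) + y)
  lemma = solve-∀

P[1+x]-k≡Px+[P-k] : ∀ P x k → P * (1ℤ + x) - k ≡ P * x + (P - k)
P[1+x]-k≡Px+[P-k] = solve-∀

+[pqr]-k≡+p*+q*+r-k : ∀ p q r k → + (p ℕ.* q ℕ.* r) - k ≡ + p * + q * + r - k
+[pqr]-k≡+p*+q*+r-k p q r k = cong (_- k) (trans (pos-* (p ℕ.* q) r) (cong (_* + r) (pos-* p q)))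

p≤2+∣k∣ : ∀ {k p q r} → AtLeastThreePrimeFactors k → Prime p → Prime q → Prime r →
          InC k (p ℕ.* q ℕ.* r) → (p ℕ.∸ 1) ℕ.∣ (q ℕ.∸ 1) → (p ℕ.∸ 1) ℕ.∣ (r ℕ.∸ 1) →
          p ℕ.≤ 2 ℕ.+ ∣ k ∣
p≤2+∣k∣ {k} {p@(suc p′)} {q@(suc q′)} {r@(suc r′)} Ω pp pq pr inC p′∣q′ p′∣r′ = s≤s (begin
  p′           ≤⟨ ∣⇒∣∣≤∣∣ p′∣1-k 1-k≢0 ⟩
  ∣ 1ℤ - k ∣   ≤⟨ ∣i-j∣≤∣i∣+∣j∣ 1ℤ k ⟩
  1 ℕ.+ ∣ k ∣  ∎)
  where
  open ℕ.≤-Reasoning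
  p′∣n-k : + p′ ∣ + p * + q * + r - k
  p′∣n-k = subst (+ p′ ∣_) (+[pqr]-k≡+p*+q*+r-k p q r k)
    (InC⇒p-1∣n-k inC pp (ℕ.∣-trans (ℕ.m∣m*n q) (ℕ.m∣m*n r)))
  p′∣1-k : + p′ ∣ 1ℤ - k
  p′∣1-k = w∣n-k⇒w∣1-k (+ p′) (+ q′) (+ r′) k (∣ᵤ⇒∣ p′∣q′) (∣ᵤ⇒∣ p′∣r′) p′∣n-k
  1-k≢0 : 1ℤ - k ≢ 0ℤ
  1-k≢0 1-k≡0 = Ω≥3⇒≢1 Ω (sym (i-j≡0⇒i≡j 1ℤ k 1-k≡0))

q∸1,r∸1≤mutualDivisorBound :
  ∀ {k p q r} → AtLeastThreePrimeFactors k → Prime p → Prime q → Prime r → InC k (p ℕ.* q ℕ.* r) →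
  (q ℕ.∸ 1) ℕ.≤ mutualDivisorBound p ∣ + p - k ∣ × (r ℕ.∸ 1) ℕ.≤ mutualDivisorBound p ∣ + p - k ∣
q∸1,r∸1≤mutualDivisorBound {k} {p@(suc _)} {q@(suc q′)} {r@(suc r′)} Ω pp pq pr inC =
  mutual-∣⇒≤ p (ℕ.≤-pred (prime⇒2≤p pq)) (ℕ.≤-pred (prime⇒2≤p pr)) D≢0 (Ps+D≢0 pq) (Ps+D≢0 pr)
    (subst (+ q′ ∣_) (P[1+x]-k≡Px+[P-k] (+ p) (+ r′) k) (x∣n-k⇒x∣P[1+y]-k (+ p) (+ q′) (+ r′) k q′∣n-k))
    (subst (+ r′ ∣_) (P[1+x]-k≡Px+[P-k] (+ p) (+ q′) k) (y∣n-k⇒y∣P[1+x]-k (+ p) (+ q′) (+ r′) k r′∣n-k))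
  where
  D : ℤ
  D = + p - k
  q′∣n-k : + q′ ∣ + p * + q * + r - k
  q′∣n-k = subst (+ q′ ∣_) (+[pqr]-k≡+p*+q*+r-k p q r k) (InC⇒p-1∣n-k inC pq (ℕ.n∣m*n*o p r))
  r′∣n-k : + r′ ∣ + p * + q * + r - k
  r′∣n-k = subst (+ r′ ∣_) (+[pqr]-k≡+p*+q*+r-k p q r k) (InC⇒p-1∣n-k inC pr (ℕ.n∣m*n (p ℕ.* q)))
  D≢0 : D ≢ 0ℤ
  D≢0 D≡0 = Ω≥3⇒≢p Ω pp (sym (i-j≡0⇒i≡j (+ p) k D≡0))
  Ps+D≢0 : ∀ {s} → Prime (suc s) → + p * + s + D ≢ 0ℤ
  Ps+D≢0 {s} ps Ps+D≡0 = Ω≥3⇒≢pq Ω pp ps (sym (i-j≡0⇒i≡j (+ (p ℕ.* suc s)) k (begin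
    + (p ℕ.* suc s) - k   ≡⟨ cong (_- k) (pos-* p (suc s)) ⟩
    + p * (1ℤ + + s) - k  ≡⟨ P[1+x]-k≡Px+[P-k] (+ p) (+ s) k ⟩
    + p * + s + D         ≡⟨ Ps+D≡0 ⟩
    0ℤ                    ∎)))
    where open ≡-Reasoning

proposition5p4 : (k : ℤ) → AtLeastThreePrimeFactors k →
    Σ ℕ λ B → (p q r : ℕ) → Prime p → Prime q → Prime r →
      InC k (p ℕ.* q ℕ.* r) → (p ℕ.∸ 1) ℕ.∣ (q ℕ.∸ 1) → (p ℕ.∸ 1) ℕ.∣ (r ℕ.∸ 1) →
      (p ℕ.≤ B) × (q ℕ.≤ B) × (r ℕ.≤ B)
proposition5p4 k Ω = suc M , bounds
  where
  P₀ M : ℕ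
  P₀ = 2 ℕ.+ ∣ k ∣
  M = mutualDivisorBound P₀ (P₀ ℕ.+ ∣ k ∣)
  bounds : (p q r : ℕ) → Prime p → Prime q → Prime r →
           InC k (p ℕ.* q ℕ.* r) → (p ℕ.∸ 1) ℕ.∣ (q ℕ.∸ 1) → (p ℕ.∸ 1) ℕ.∣ (r ℕ.∸ 1) →
           (p ℕ.≤ suc M) × (q ℕ.≤ suc M) × (r ℕ.≤ suc M)
  bounds p@(suc _) q@(suc _) r@(suc _) pp pq pr inC p-1∣q-1 p-1∣r-1 =
    ℕ.m≤n⇒m≤1+n p≤M , s≤s (ℕ.≤-trans q-1≤ mono) , s≤s (ℕ.≤-trans r-1≤ mono)
    where
    p≤P₀ : p ℕ.≤ P₀
    p≤P₀ = p≤2+∣k∣ Ω pp pq pr inC p-1∣q-1 p-1∣r-1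
    p≤M : p ℕ.≤ M
    p≤M = ℕ.≤-trans p≤P₀ (ℕ.≤-trans (ℕ.m≤m+n P₀ ∣ k ∣) (d≤mutualDivisorBound P₀ (P₀ ℕ.+ ∣ k ∣)))
    q-1≤ : (q ℕ.∸ 1) ℕ.≤ mutualDivisorBound p ∣ + p - k ∣
    q-1≤ = proj₁ (q∸1,r∸1≤mutualDivisorBound Ω pp pq pr inC)
    r-1≤ : (r ℕ.∸ 1) ℕ.≤ mutualDivisorBound p ∣ + p - k ∣
    r-1≤ = proj₂ (q∸1,r∸1≤mutualDivisorBound Ω pp pq pr inC)
    mono : mutualDivisorBound p ∣ + p - k ∣ ℕ.≤ M
    mono = mutualDivisorBound-mono p≤P₀ (ℕ.≤-trans (∣i-j∣≤∣i∣+∣j∣ (+ p) k) (ℕ.+-monoˡ-≤ ∣ k ∣ p≤P₀))
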